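{- Let $\sigma$ be an $n$-cycle of $\{1,\dots,n\}$ and $D_\sigma$ its oriented cycle diagram. There is a unique maximal Seifert circle of $D_\sigma$ with respect to the partial order $\prec$; every other Seifert circle of $D_\sigma$ lies in the bounded region enclosed by it.
   Context: Cycle diagram $D_\sigma$: for each $i$, draw a vertical segment from $(i,i)$ to $(i,\sigma(i))$ and a horizontal segment from $(i,\sigma(i))$ to $(\sigma(i),\sigma(i))$, read as a knot diagram with the vertical segment over at every crossing, oriented so that the segments from $(i,i)$ are traversed from $(i,i)$ to $(\sigma(i),\sigma(i))$. The Seifert circles are the disjoint simple closed planar curves obtained by smoothing every crossing (removing the crossing point and reconnecting the ends coherently with the orientation so the strands no longer cross). For Seifert circles $S,S'$, $S'\prec S$ means $S'$ is contained in the bounded planar region enclosed by $S$. -}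

module Defs where

open import Data.Nat using (ℕ; zero; suc; _<_; _≤_; _⊓_)
open import Data.Fin using (Fin; toℕ)
open import Data.Fin.Permutation using (Permutation′; _⟨$⟩ʳ_)
open import Data.Bool using (Bool; true; false; not)
open import Data.Product using (_×_; _,_; ∃-syntax; ∃₂)
open import Data.Sum using (_⊎_)
open import Data.List using (List; []; _∷_; upTo)
open import Relation.Binary.PropositionalEquality using (_≡_; _≢_)
open import Relation.Nullary using (¬_)
open import Relation.Binary.Construct.Closure.Equivalence using (EqClosure)

iter : ∀ {A : Set} → (A → A) → ℕ → A → A
iter f zero x = x
iter f (suc k) x = f (iter f k x)

data Parity {A : Set} (P : A → Set) : List A → Bool → Set where
  nil  : Parity P [] false
  hit  : ∀ {x xs b} → P x → Parity P xs b → Parity P (x ∷ xs) (not b)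
  miss : ∀ {x xs b} → ¬ P x → Parity P xs b → Parity P (x ∷ xs) b

-- The cycle diagram D_σ on the integer grid, with coordinates 0,…,n-1
-- (point (i,i) for i : Fin n is encoded as (toℕ i , toℕ i)).
module CycleDiagram {n : ℕ} (σ : Permutation′ n) where

  s : Fin n → Fin n
  s i = σ ⟨$⟩ʳ i

  IsNCycle : Set
  IsNCycle = ∀ (i j : Fin n) → ∃[ k ] (iter s k i ≡ j)

  -- u → v is a unit step inside the closed interval between a and b,
  -- directed from a towards b
  Step : ℕ → ℕ → ℕ → ℕ → Set
  Step a b u v = (a < b × a ≤ u × v ≡ suc u × v ≤ b) ⊎ (b < a × b ≤ v × u ≡ suc v × u ≤ a)

  StrictlyBetween : ℕ → ℕ → ℕ → Set
  StrictlyBetween a b x = (a < x × x < b) ⊎ (b < x × x < a)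

  -- A directed unit edge of D_σ (the segments subdivided at lattice points).
  -- vertical = true : edge (i , from) → (i , to) of the vertical segment (i,i)–(i,σi)
  -- vertical = false: edge (from , σi) → (to , σi) of the horizontal segment (i,σi)–(σi,σi)
  record Edge : Set where
    constructor edge
    field
      strand   : Fin n
      vertical : Bool
      from     : ℕ
      to       : ℕ
      step     : Step (toℕ strand) (toℕ (s strand)) from to

  open Edge public

  Point : Set
  Point = ℕ × ℕ

  start : Edge → Point
  start (edge i true  u v _) = (toℕ i , u)
  start (edge i false u v _) = (u , toℕ (s i))

  end : Edge → Point
  end (edge i true  u v _) = (toℕ i , v)
  end (edge i false u v _) = (v , toℕ (s i))

  IsCrossing : Point → Set
  IsCrossing (x , y) = ∃₂ λ (a b : Fin n) →
    toℕ a ≡ x × StrictlyBetween (toℕ a) (toℕ (s a)) y ×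
    toℕ (s b) ≡ y × StrictlyBetween (toℕ b) (toℕ (s b)) x

  -- Oriented (Seifert) smoothing: after edge e, the curve continues along e'.
  -- At a crossing it switches to the outgoing edge of the other strand
  -- (the one of the other direction); elsewhere it follows the unique outgoing edge.
  Succ : Edge → Edge → Set
  Succ e e' = end e ≡ start e' × (IsCrossing (end e) → vertical e ≢ vertical e')

  SameCircle : Edge → Edge → Set
  SameCircle = EqClosure Succ

  -- The midpoint of edge f lies in the bounded region enclosed by the Seifert
  -- circle of S (ray-crossing parity).  For a vertical f with midpoint
  -- (x , y+1/2) a ray to the right is used; for a horizontal f with midpoint
  -- (x+1/2 , y) a ray upwards.
  InsideAt : Edge → Edge → Set
  InsideAt S (edge i true u v _) =
    Parity (λ c → toℕ i < c × ∃[ g ] (vertical g ≡ true × toℕ (strand g) ≡ c ×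
                                       (from g ⊓ to g) ≡ (u ⊓ v) × SameCircle g S))
           (upTo n) true
  InsideAt S (edge i false u v _) =
    Parity (λ r → toℕ (s i) < r × ∃[ g ] (vertical g ≡ false × toℕ (s (strand g)) ≡ r ×
                                          (from g ⊓ to g) ≡ (u ⊓ v) × SameCircle g S))
           (upTo n) true

  _≺_ : Edge → Edge → Set
  T ≺ S = ¬ SameCircle T S × (∀ f → SameCircle f T → InsideAt S f)

  Maximal : Edge → Set
  Maximal S = ∀ T → ¬ (S ≺ T)

-- Call an edge outer if it ascends and nothing of D_σ lies to its left (vertical edge) or above
-- it (horizontal edge), or if it descends and nothing lies to its right or below it.  Smoothing a
-- crossing or turning a corner never leaves or enters the set of outer edges, and from any outer
-- edge the successors climb (in x + y) along ascending outer edges and then descend back to the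
-- origin, where the bottom edge S₀ of column 0 follows; so the outer edges form precisely the
-- Seifert circle of S₀.  Since σ is an n-cycle, every cut between two consecutive coordinates is
-- crossed by σ in both directions; hence the horizontal ray to the right of any other edge meets
-- the outer circle exactly once (at the rightmost strand descending across it), and likewise the
-- vertical ray above it (at the topmost strand ascending across it).  So every other circle lies
-- inside the circle of S₀, while the ray to the right of S₀ meets only outer edges, so the circle
-- of S₀ lies inside no other circle.

module Submission where

open import Defs
open import Data.Nat using (ℕ; zero; suc; _+_; _⊓_; _≤_; _<_; z≤n; s≤s; s≤s⁻¹; _≤?_; _<?_)
open import Data.Nat.Properties
open import Data.Fin using (Fin; toℕ; fromℕ<) renaming (zero to fzero; suc to fsuc)
open import Data.Fin.Properties using (toℕ-injective; toℕ<n; toℕ-fromℕ<; all?)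
open import Data.Fin.Permutation using (Permutation′; _⟨$⟩ˡ_; inverseʳ)
open import Data.Bool using (Bool; true; false)
open import Data.Product using (Σ; ∃; ∃-syntax; _×_; _,_; proj₁; proj₂)
open import Data.Product.Properties using (,-injectiveˡ; ,-injectiveʳ)
open import Data.Sum using (_⊎_; inj₁; inj₂; [_,_]′)
open import Data.Empty using (⊥; ⊥-elim)
open import Data.List using (List; upTo; applyUpTo; allFin; filter)
open import Data.List.Extrema.Nat using (argmax; argmax-all; f[xs]≤f[argmax])
open import Data.List.Membership.Propositional.Properties using (∈-allFin; ∈-filter⁺)
open import Data.List.Relation.Unary.All using (lookup)
open import Data.List.Relation.Unary.All.Properties using (all-filter)
open import Function using (_∘_; id)
open import Function.Bundles using (Injection)
open import Function.Properties.Inverse using (↔⇒↣)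
open import Level using (0ℓ)
open import Relation.Binary.PropositionalEquality
open import Relation.Binary.Definitions using (tri<; tri≈; tri>)
open import Relation.Binary.Construct.Closure.Equivalence using (EqClosure)
import Relation.Binary.Construct.Closure.Equivalence as EqClosure
open import Relation.Binary.Construct.Closure.ReflexiveTransitive using (ε; _◅_)
open import Relation.Binary.Construct.Closure.Symmetric using (fwd; bwd)
open import Relation.Nullary using (¬_; Dec; yes; no)
open import Relation.Nullary.Decidable using (_×-dec_; _⊎-dec_; _→-dec_)
open import Relation.Unary using (Pred; Decidable)

pattern ascending  a<b a≤u v≤b = inj₁ (a<b , a≤u , refl , v≤b)
pattern descending b<a b≤v u≤a = inj₂ (b<a , b≤v , refl , u≤a)

Parity-false : ∀ {A : Set} {P : A → Set} {xs b} → (∀ x → ¬ P x) → Parity P xs b → b ≡ false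
Parity-false ¬P nil        = refl
Parity-false ¬P (hit p _)  = ⊥-elim (¬P _ p)
Parity-false ¬P (miss _ q) = Parity-false ¬P q

Parity-applyUpTo-none : ∀ {A : Set} {P : A → Set} (f : ℕ → A) t →
                        (∀ i → ¬ P (f i)) → Parity P (applyUpTo f t) false
Parity-applyUpTo-none f zero    ¬P = nil
Parity-applyUpTo-none f (suc t) ¬P = miss (¬P 0) (Parity-applyUpTo-none (f ∘ suc) t (¬P ∘ suc))

Parity-applyUpTo-unique : ∀ {A : Set} {P : A → Set} (f : ℕ → A) {t} k → k < t → P (f k) →
                          (∀ i → P (f i) → i ≡ k) → Parity P (applyUpTo f t) true
Parity-applyUpTo-unique f {suc t} zero    _   p uniq =
  hit p (Parity-applyUpTo-none (f ∘ suc) t (λ i q → 1+n≢0 (uniq (suc i) q)))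
Parity-applyUpTo-unique f {suc t} (suc k) k<t p uniq =
  miss (λ q → 0≢1+n (uniq 0 q))
       (Parity-applyUpTo-unique (f ∘ suc) k (s≤s⁻¹ k<t) p (λ i q → suc-injective (uniq (suc i) q)))

iter-fixed : ∀ {A : Set} (f : A → A) {x} → f x ≡ x → ∀ k → iter f k x ≡ x
iter-fixed f fx zero    = refl
iter-fixed f fx (suc k) = trans (cong f (iter-fixed f fx k)) fx

iter-crossing : ∀ {A : Set} {Q : A → Set} → (∀ x → Dec (Q x)) → (f : A → A) →
                ∀ k {x} → ¬ Q x → Q (iter f k x) → ∃[ b ] (¬ Q b × Q (f b))
iter-crossing Q? f zero    ¬q q = ⊥-elim (¬q q)
iter-crossing Q? f (suc k) {x} ¬q q with Q? (iter f k x)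
... | yes q′ = iter-crossing Q? f k ¬q q′
... | no ¬q′ = iter f k x , ¬q′ , q

max-satisfying : ∀ {n} {Q : Pred (Fin n) 0ℓ} → Decidable Q → (key : Fin n → ℕ) →
                 ∀ {c₀} → Q c₀ → ∃[ c ] (Q c × (∀ d → Q d → key d ≤ key c))
max-satisfying {n} Q? key {c₀} q₀ =
  c , argmax-all key q₀ (all-filter Q? (allFin n)) ,
  λ d q → lookup (f[xs]≤f[argmax] c₀ candidates) (∈-filter⁺ Q? (∈-allFin d) q)
  where
  candidates : List (Fin n)
  candidates = filter Q? (allFin n)
  c : Fin n
  c = argmax key c₀ candidates

module Smoothing {n : ℕ} (σ : Permutation′ n) where
  open CycleDiagram σ

  sv : Fin n → ℕ
  sv i = toℕ (s i)

  s-injective : ∀ {i j} → s i ≡ s j → i ≡ j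
  s-injective = Injection.injective (↔⇒↣ σ)

  sv-injective : ∀ {i j} → sv i ≡ sv j → i ≡ j
  sv-injective = s-injective ∘ toℕ-injective

  StrictlyBetween? : ∀ a b x → Dec (StrictlyBetween a b x)
  StrictlyBetween? a b x = ((a <? x) ×-dec (x <? b)) ⊎-dec ((b <? x) ×-dec (x <? a))

  StrictlyBetween⇒<n : ∀ i {x} → StrictlyBetween (toℕ i) (sv i) x → x < n
  StrictlyBetween⇒<n i (inj₁ (_ , x<σi)) = <-trans x<σi (toℕ<n (s i))
  StrictlyBetween⇒<n i (inj₂ (_ , x<i))  = <-trans x<i (toℕ<n i)

  Step⇒≢ : ∀ {a b u v} → Step a b u v → a ≢ b
  Step⇒≢ (inj₁ (a<b , _)) = <⇒≢ a<b
  Step⇒≢ (inj₂ (b<a , _)) = ≢-sym (<⇒≢ b<a)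

  Step-from<n : ∀ {i u v} → Step (toℕ i) (sv i) u v → u < n
  Step-from<n {i} (ascending  _ _ u<σi) = <-trans u<σi (toℕ<n (s i))
  Step-from<n {i} (descending _ _ u≤i)  = ≤-<-trans u≤i (toℕ<n i)

  Step-end : ∀ {a b u v} → Step a b u v → v ≡ b ⊎ StrictlyBetween a b v
  Step-end (ascending _ a≤u v≤b) with m≤n⇒m<n∨m≡n v≤b
  ... | inj₁ v<b = inj₂ (inj₁ (s≤s a≤u , v<b))
  ... | inj₂ v≡b = inj₁ v≡b
  Step-end (descending _ b≤v u≤a) with m≤n⇒m<n∨m≡n b≤v
  ... | inj₁ b<v = inj₂ (inj₂ (b<v , u≤a))
  ... | inj₂ b≡v = inj₁ (sym b≡v)

  StepStart : ℕ → ℕ → ℕ → Set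
  StepStart a b u = (a < b × a ≤ u × u < b) ⊎ (b < a × b < u × u ≤ a)

  StepStart-first : ∀ {a b} → a ≢ b → StepStart a b a
  StepStart-first {a} {b} a≢b with <-cmp a b
  ... | tri< a<b _ _ = inj₁ (a<b , ≤-refl , a<b)
  ... | tri≈ _ a≡b _ = ⊥-elim (a≢b a≡b)
  ... | tri> _ _ b<a = inj₂ (b<a , b<a , ≤-refl)

  StepStart-inner : ∀ {a b x} → StrictlyBetween a b x → StepStart a b x
  StepStart-inner (inj₁ (a<x , x<b)) = inj₁ (<-trans a<x x<b , <⇒≤ a<x , x<b)
  StepStart-inner (inj₂ (b<x , x<a)) = inj₂ (<-trans b<x x<a , b<x , <⇒≤ x<a)

  step-from : ∀ {a b u} → StepStart a b u → ∃ (Step a b u)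
  step-from {u = u}     (inj₁ (a<b , a≤u , u<b)) = suc u , ascending a<b a≤u u<b
  step-from {u = suc w} (inj₂ (b<a , b<u , u≤a)) = w , descending b<a (s≤s⁻¹ b<u) u≤a

  edge-from : (i : Fin n) → Bool → (u : ℕ) → StepStart (toℕ i) (sv i) u → Edge
  edge-from i vert u p = edge i vert u (proj₁ (step-from p)) (proj₂ (step-from p))

  LeavesFrom : Point → Bool → Set
  LeavesFrom p vert = Σ Edge λ e′ → p ≡ start e′ × (IsCrossing p → vert ≢ vertical e′)

  leave-vertical : ∀ i {v} b → sv b ≡ v → StrictlyBetween (toℕ i) (sv i) v →
                   LeavesFrom (toℕ i , v) true
  leave-vertical i b σb≡v inside with StrictlyBetween? (toℕ b) (sv b) (toℕ i)
  ... | yes crosses =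
    edge-from b false (toℕ i) (StepStart-inner crosses) , cong (toℕ i ,_) (sym σb≡v) , λ _ ()
  ... | no ¬crosses =
    edge-from i true _ (StepStart-inner inside) , refl , λ (_ , b′ , _ , _ , σb′≡v , crosses) _ →
      ¬crosses (subst (λ c → StrictlyBetween (toℕ c) (sv c) (toℕ i))
                      (sv-injective (trans σb′≡v (sym σb≡v))) crosses)

  leave-horizontal : ∀ i {v} c → toℕ c ≡ v → StrictlyBetween (toℕ i) (sv i) v →
                     LeavesFrom (v , sv i) false
  leave-horizontal i c c≡v inside with StrictlyBetween? (toℕ c) (sv c) (sv i)
  ... | yes crosses =
    edge-from c true (sv i) (StepStart-inner crosses) , cong (_, sv i) (sym c≡v) , λ _ ()
  ... | no ¬crosses =
    edge-from i false _ (StepStart-inner inside) , refl , λ (c′ , _ , c′≡v , crosses , _) _ →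
      ¬crosses (subst (λ d → StrictlyBetween (toℕ d) (sv d) (sv i))
                      (toℕ-injective (trans c′≡v (sym c≡v))) crosses)

  successor : ∀ e → Σ Edge (Succ e)
  successor (edge i true u v st) with Step-end st
  ... | inj₁ v≡σi =
    edge-from i false (toℕ i) (StepStart-first (Step⇒≢ st)) , cong (toℕ i ,_) v≡σi , λ _ ()
  ... | inj₂ inside =
    leave-vertical i (σ ⟨$⟩ˡ fromℕ< v<n) (trans (cong toℕ (inverseʳ σ)) (toℕ-fromℕ< v<n)) inside
    where
    v<n : v < n
    v<n = StrictlyBetween⇒<n i inside
  successor (edge i false u v st) with Step-end st
  ... | inj₁ v≡σi =
    edge-from (s i) true (sv i) (StepStart-first σi≢σσi) , cong (_, sv i) v≡σi , λ _ ()
    where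
    σi≢σσi : sv i ≢ sv (s i)
    σi≢σσi eq = Step⇒≢ st (cong toℕ (s-injective (toℕ-injective eq)))
  ... | inj₂ inside = leave-horizontal i (fromℕ< v<n) (toℕ-fromℕ< v<n) inside
    where
    v<n : v < n
    v<n = StrictlyBetween⇒<n i inside

  data SuccView : Edge → Edge → Set where
    along-vertical      : ∀ {i u v w st st′} → ¬ IsCrossing (toℕ i , v) →
                          SuccView (edge i true u v st) (edge i true v w st′)
    along-horizontal    : ∀ {i u v w st st′} → ¬ IsCrossing (v , sv i) →
                          SuccView (edge i false u v st) (edge i false v w st′)
    vertical→horizontal : ∀ {i j u v x w st st′} → x ≡ toℕ i → v ≡ sv j →
                          SuccView (edge i true u v st) (edge j false x w st′)
    horizontal→vertical : ∀ {i j u v y w st st′} → v ≡ toℕ j → y ≡ sv i →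
                          SuccView (edge i false u v st) (edge j true y w st′)

  succView : ∀ {e e′} → Succ e e′ → SuccView e e′
  succView {edge _ true _ _ _} {edge _ true _ _ _} (meet , switch)
    with toℕ-injective (,-injectiveˡ meet) | ,-injectiveʳ meet
  ... | refl | refl = along-vertical (λ crossing → switch crossing refl)
  succView {edge _ false _ _ _} {edge _ false _ _ _} (meet , switch)
    with ,-injectiveˡ meet | sv-injective (,-injectiveʳ meet)
  ... | refl | refl = along-horizontal (λ crossing → switch crossing refl)
  succView {edge _ true _ _ _} {edge _ false _ _ _} (meet , _) =
    vertical→horizontal (sym (,-injectiveˡ meet)) (,-injectiveʳ meet)
  succView {edge _ false _ _ _} {edge _ true _ _ _} (meet , _) =
    horizontal→vertical (,-injectiveˡ meet) (sym (,-injectiveʳ meet))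

  SameCircle-sym : ∀ {e e′} → SameCircle e e′ → SameCircle e′ e
  SameCircle-sym = EqClosure.symmetric Succ

  SameCircle-trans : ∀ {e e′ e″} → SameCircle e e′ → SameCircle e′ e″ → SameCircle e e″
  SameCircle-trans = EqClosure.transitive Succ

  VerticalOn HorizontalOn : Edge → ℕ → ℕ → Set
  VerticalOn S y c =
    ∃[ g ] (vertical g ≡ true × toℕ (strand g) ≡ c × (from g ⊓ to g) ≡ y × SameCircle g S)
  HorizontalOn S x r =
    ∃[ g ] (vertical g ≡ false × sv (strand g) ≡ r × (from g ⊓ to g) ≡ x × SameCircle g S)

module OuterCircle (m : ℕ) (σ : Permutation′ (suc (suc m))) (cycle : CycleDiagram.IsNCycle σ) where
  open CycleDiagram σ
  open Smoothing σ

  N : ℕ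
  N = suc (suc m)

  no-fixed-point : ∀ i → s i ≢ i
  no-fixed-point i fixed with cycle i fzero | cycle i (fsuc fzero)
  ... | k , reach₀ | l , reach₁
    with trans (sym (iter-fixed s fixed k)) reach₀ | trans (sym (iter-fixed s fixed l)) reach₁
  ... | refl | ()

  cut-crossed-upward : ∀ t → 0 < t → t < N → ∃[ b ] (toℕ b < t × t ≤ sv b)
  cut-crossed-upward t 0<t t<N with cycle fzero (fromℕ< t<N)
  ... | k , reach
    with iter-crossing (λ x → t ≤? toℕ x) s k (<⇒≱ 0<t)
                       (subst (λ x → t ≤ toℕ x) (sym reach) (≤-reflexive (sym (toℕ-fromℕ< t<N))))
  ... | b , b≱t , t≤σb = b , ≰⇒> b≱t , t≤σb

  cut-crossed-downward : ∀ t → 0 < t → t < N → ∃[ b ] (t ≤ toℕ b × sv b < t)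
  cut-crossed-downward t 0<t t<N with cycle (fromℕ< t<N) fzero
  ... | k , reach
    with iter-crossing (λ x → toℕ x <? t) s k {fromℕ< t<N}
                       (≤⇒≯ (≤-reflexive (sym (toℕ-fromℕ< t<N))))
                       (subst (λ x → toℕ x < t) (sym reach) 0<t)
  ... | b , b≮t , σb<t = b , ≮⇒≥ b≮t , σb<t

  -- Applied to an edge of strand i at height y + ½ (abscissa x + ½), these say that no segment
  -- of D_σ meets the ray from its midpoint to the left (right, upwards, downwards).
  ClearLeft ClearRight ClearAbove ClearBelow : Fin N → ℕ → Set
  ClearLeft  i y = ∀ c → toℕ c < toℕ i → sv c ≤ y
  ClearRight i y = ∀ c → toℕ i < toℕ c → y < sv c
  ClearAbove i x = ∀ b → sv i < sv b → x < toℕ b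
  ClearBelow i x = ∀ b → sv b < sv i → toℕ b ≤ x

  Up : Edge → Set
  Up (edge i true  u _ (inj₁ _)) = ClearLeft i u
  Up (edge i false u _ (inj₁ _)) = ClearAbove i u
  Up (edge _ true  _ _ (inj₂ _)) = ⊥
  Up (edge _ false _ _ (inj₂ _)) = ⊥

  Down : Edge → Set
  Down (edge i true  _ v (inj₂ _)) = ClearRight i v
  Down (edge i false _ v (inj₂ _)) = ClearBelow i v
  Down (edge _ true  _ _ (inj₁ _)) = ⊥
  Down (edge _ false _ _ (inj₁ _)) = ⊥

  Outer : Edge → Set
  Outer e = Up e ⊎ Down e

  Outer? : ∀ e → Dec (Outer e)
  Outer? e = Up? e ⊎-dec Down? e
    where
    Up? : ∀ e → Dec (Up e)
    Up? (edge i true  u _ (inj₁ _)) = all? λ c → (toℕ c <? toℕ i) →-dec (sv c ≤? u)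
    Up? (edge i false u _ (inj₁ _)) = all? λ b → (sv i <? sv b) →-dec (u <? toℕ b)
    Up? (edge _ true  _ _ (inj₂ _)) = no λ ()
    Up? (edge _ false _ _ (inj₂ _)) = no λ ()
    Down? : ∀ e → Dec (Down e)
    Down? (edge i true  _ v (inj₂ _)) = all? λ c → (toℕ i <? toℕ c) →-dec (v <? sv c)
    Down? (edge i false _ v (inj₂ _)) = all? λ b → (sv b <? sv i) →-dec (toℕ b ≤? v)
    Down? (edge _ true  _ _ (inj₁ _)) = no λ ()
    Down? (edge _ false _ _ (inj₁ _)) = no λ ()

  ClearLeft-corner : ∀ {i u} → ClearLeft i u → u < sv i → ClearAbove i (toℕ i)
  ClearLeft-corner {i} clear u<σi b σi<σb = ≰⇒> λ b≤i →
    [ left-of-i , (λ b≡i → <-irrefl (cong sv (sym (toℕ-injective b≡i))) σi<σb) ]′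
      (m≤n⇒m<n∨m≡n b≤i)
    where
    left-of-i : toℕ b < toℕ i → ⊥
    left-of-i b<i = <⇒≱ (<-trans u<σi σi<σb) (clear b b<i)

  ClearAbove-corner : ∀ {i u} → ClearAbove i (toℕ i) → suc u ≡ sv i → ClearLeft i u
  ClearAbove-corner {i} clear u+1≡σi c c<i =
    m<1+n⇒m≤n (subst (sv c <_) (sym u+1≡σi) (≰⇒> λ σi≤σc →
      [ above-i , (λ σi≡σc → <-irrefl (cong toℕ (sv-injective (sym σi≡σc))) c<i) ]′
        (m≤n⇒m<n∨m≡n σi≤σc)))
    where
    above-i : sv i < sv c → ⊥
    above-i σi<σc = <-asym c<i (clear c σi<σc)

  ClearRight-corner : ∀ {i v w} → ClearRight i v → sv i ≤ v → suc w ≡ toℕ i → ClearBelow i w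
  ClearRight-corner {i} clear σi≤v w+1≡i b σb<σi =
    s≤s⁻¹ (subst (toℕ b <_) (sym w+1≡i) (≰⇒> λ i≤b →
      [ right-of-i , (λ i≡b → <-irrefl (cong sv (sym (toℕ-injective i≡b))) σb<σi) ]′
        (m≤n⇒m<n∨m≡n i≤b)))
    where
    right-of-i : toℕ i < toℕ b → ⊥
    right-of-i i<b = <⇒≱ (clear b i<b) (≤-trans (<⇒≤ σb<σi) σi≤v)

  ClearBelow-corner : ∀ {i w} → ClearBelow i w → suc w ≡ toℕ i → ClearRight i (sv i)
  ClearBelow-corner {i} clear w+1≡i c i<c = ≰⇒> λ σc≤σi →
    [ below-i , (λ σc≡σi → <-irrefl (cong toℕ (sv-injective (sym σc≡σi))) i<c) ]′
      (m≤n⇒m<n∨m≡n σc≤σi)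
    where
    below-i : sv c < sv i → ⊥
    below-i σc<σi = <-asym i<c (subst (toℕ c <_) w+1≡i (s≤s (clear c σc<σi)))

  Up-succ : ∀ {e e′} → SuccView e e′ → Up e → Outer e′
  Up-succ (along-vertical {st = ascending _ _ _} {st′ = ascending _ _ _} _) clear =
    inj₁ λ c c<i → m≤n⇒m≤1+n (clear c c<i)
  Up-succ (along-horizontal {i} {st = ascending _ i≤u _} {st′ = ascending _ _ u+1<σi} ¬crossing) clear =
    inj₁ λ b σi<σb → ≤∧≢⇒< (clear b σi<σb) λ u+1≡b → ¬crossing
      (b , i , sym u+1≡b , inj₁ (subst (_< sv i) u+1≡b u+1<σi , σi<σb) ,
       refl , inj₁ (s≤s i≤u , u+1<σi))
  Up-succ (vertical→horizontal {j = j} {st = ascending _ _ u<σi} {st′ = ascending _ j≤i _}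
                               refl u+1≡σj) clear
    with toℕ-injective (≤-antisym j≤i (≮⇒≥ λ j<i → <⇒≱ (≤-reflexive u+1≡σj) (clear j j<i)))
  ... | refl = inj₁ (ClearLeft-corner clear u<σi)
  Up-succ (vertical→horizontal {st = ascending _ i≤u _} {st′ = descending _ σj≤w _} w+1≡i u+1≡σj) _ =
    ⊥-elim (<⇒≱ (≤-reflexive u+1≡σj)
                (≤-trans σj≤w (≤-trans (n≤1+n _) (≤-trans (≤-reflexive w+1≡i) i≤u))))
  Up-succ (horizontal→vertical {st = ascending _ _ _} {st′ = ascending _ _ _} u+1≡j refl) clear =
    inj₁ λ c c<j → ≮⇒≥ λ σi<σc →
      <⇒≱ (clear c σi<σc) (s≤s⁻¹ (subst (_ <_) (sym u+1≡j) c<j))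
  Up-succ (horizontal→vertical {j = j} {st = ascending _ _ _} {st′ = descending σj<j _ y≤j}
                               u+1≡j y≡σi) clear =
    inj₂ λ c j<c → ⊥-elim (nothing-right-of-j c j<c)
    where
    nothing-right-of-j : ∀ c → toℕ j < toℕ c → ⊥
    nothing-right-of-j c j<c with cut-crossed-upward (suc (toℕ j)) (s≤s z≤n) (≤-<-trans j<c (toℕ<n c))
    ... | b , b≤j , j<σb
      with toℕ-injective {i = b} {j} (≤-antisym (s≤s⁻¹ b≤j) (subst (_≤ toℕ b) u+1≡j
             (clear b (≤-<-trans (≤-trans (≤-reflexive (sym y≡σi)) y≤j) j<σb))))
    ... | refl = <-asym σj<j j<σb
  Up-succ (along-vertical {st = ascending i<σi _ _} {st′ = descending σi<i _ _} _) _ =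
    ⊥-elim (<-asym i<σi σi<i)
  Up-succ (along-horizontal {st = ascending i<σi _ _} {st′ = descending σi<i _ _} _) _ =
    ⊥-elim (<-asym i<σi σi<i)
  Up-succ (along-vertical      {st = inj₂ _} _)   ()
  Up-succ (along-horizontal    {st = inj₂ _} _)   ()
  Up-succ (vertical→horizontal {st = inj₂ _} _ _) ()
  Up-succ (horizontal→vertical {st = inj₂ _} _ _) ()

  Down-succ : ∀ {e e′} → SuccView e e′ → Down e → Down e′ ⊎ (Up e′ × end e ≡ (0 , 0))
  Down-succ (along-vertical {st = descending _ _ _} {st′ = descending _ _ _} _) clear =
    inj₁ λ c i<c → <-trans (n<1+n _) (clear c i<c)
  Down-succ (along-horizontal {i} {st = descending _ _ w+1<i} {st′ = descending _ σi≤w _} ¬crossing) clear =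
    inj₁ λ b σb<σi → m<1+n⇒m≤n (≤∧≢⇒< (clear b σb<σi) λ b≡w+1 → ¬crossing
      (b , i , b≡w+1 , inj₂ (σb<σi , subst (sv i <_) (sym b≡w+1) (s≤s σi≤w)) ,
       refl , inj₂ (s≤s σi≤w , w+1<i)))
  Down-succ (vertical→horizontal {st = descending _ _ v+1≤i} {st′ = ascending _ _ i<σj} refl v≡σj) _ =
    ⊥-elim (<⇒≱ i<σj (≤-trans (≤-reflexive (sym v≡σj)) (≤-trans (n≤1+n _) v+1≤i)))
  Down-succ (vertical→horizontal {j = j} {st = descending _ σi≤v _} {st′ = descending _ _ w+1≤j}
                                 w+1≡i v≡σj) clear
    with toℕ-injective (≤-antisym (≮⇒≥ λ i<j → <-irrefl v≡σj (clear j i<j))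
                                  (subst (_≤ toℕ j) w+1≡i w+1≤j))
  ... | refl = inj₁ (ClearRight-corner clear σi≤v w+1≡i)
  Down-succ (horizontal→vertical {i} {j} {st = descending _ σi≤v _} {st′ = ascending j<σj j≤y _}
                                 v≡j y≡σi) clear =
    inj₂ ((λ c c<j → ⊥-elim (n≮0 (subst (toℕ c <_) j≡0 c<j))) ,
          cong₂ _,_ (trans v≡j j≡0) (n≤0⇒n≡0 (≤-trans σi≤v (≤-reflexive (trans v≡j j≡0)))))
    where
    no-strand-descends-across-j : 0 < toℕ j → ⊥
    no-strand-descends-across-j 0<j with cut-crossed-downward (toℕ j) 0<j (toℕ<n j)
    ... | b , j≤b , σb<j with m≤n⇒m<n∨m≡n j≤b
    ... | inj₁ j<b =
      <⇒≱ j<b (subst (toℕ b ≤_) v≡j (clear b (<-≤-trans σb<j (subst (toℕ j ≤_) y≡σi j≤y))))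
    ... | inj₂ j≡b with toℕ-injective j≡b
    ...   | refl = <-asym j<σj σb<j
    j≡0 : toℕ j ≡ 0
    j≡0 = n≤0⇒n≡0 (≮⇒≥ no-strand-descends-across-j)
  Down-succ (horizontal→vertical {st = descending _ _ _} {st′ = descending _ _ _} v≡j y≡σi) clear =
    inj₁ λ c j<c → subst (_≤ sv c) (sym y≡σi) (≮⇒≥ λ σc<σi →
      <⇒≱ j<c (subst (toℕ c ≤_) v≡j (clear c σc<σi)))
  Down-succ (along-vertical {st = descending σi<i _ _} {st′ = ascending i<σi _ _} _) _ =
    ⊥-elim (<-asym i<σi σi<i)
  Down-succ (along-horizontal {st = descending σi<i _ _} {st′ = ascending i<σi _ _} _) _ =
    ⊥-elim (<-asym i<σi σi<i)
  Down-succ (along-vertical      {st = inj₁ _} _)   ()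
  Down-succ (along-horizontal    {st = inj₁ _} _)   ()
  Down-succ (vertical→horizontal {st = inj₁ _} _ _) ()
  Down-succ (horizontal→vertical {st = inj₁ _} _ _) ()

  Up-pred : ∀ {e e′} → SuccView e e′ → Up e′ → Outer e
  Up-pred (along-vertical {i} {st = ascending _ i≤u _} {st′ = ascending _ _ u+1<σi} ¬crossing) clear =
    inj₁ λ c c<i → m<1+n⇒m≤n (≤∧≢⇒< (clear c c<i) λ σc≡u+1 → ¬crossing
      (i , c , refl , inj₁ (s≤s i≤u , u+1<σi) ,
       σc≡u+1 , inj₁ (c<i , subst (toℕ i <_) (sym σc≡u+1) (s≤s i≤u))))
  Up-pred (along-horizontal {st = ascending _ _ _} {st′ = ascending _ _ _} _) clear =
    inj₁ λ b σi<σb → <-trans (n<1+n _) (clear b σi<σb)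
  Up-pred (vertical→horizontal {i} {st = ascending _ _ u+1≤σi} {st′ = ascending _ _ _} refl u+1≡σj) clear
    with sv-injective (≤-antisym (≮⇒≥ λ σj<σi → <-irrefl refl (clear i σj<σi))
                                 (subst (_≤ sv i) u+1≡σj u+1≤σi))
  ... | refl = inj₁ (ClearAbove-corner clear u+1≡σj)
  Up-pred (vertical→horizontal {st = descending _ _ v+1≤i} {st′ = ascending _ _ i<σj} refl v≡σj) _ =
    ⊥-elim (<⇒≱ i<σj (≤-trans (≤-reflexive (sym v≡σj)) (≤-trans (n≤1+n _) v+1≤i)))
  Up-pred (horizontal→vertical {st = ascending _ _ _} {st′ = ascending _ _ _} u+1≡j refl) clear =
    inj₁ λ b σi<σb → ≰⇒> λ b≤u → <⇒≱ σi<σb (clear b (subst (toℕ b <_) u+1≡j (s≤s b≤u)))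
  Up-pred (horizontal→vertical {i} {j} {st = descending _ σi≤v v+1≤i} {st′ = ascending _ j≤y _}
                               v≡j y≡σi) clear =
    inj₂ λ b σb<σi → ⊥-elim (no-strand-below-i b σb<σi)
    where
    σi≡j : sv i ≡ toℕ j
    σi≡j = ≤-antisym (subst (sv i ≤_) v≡j σi≤v) (subst (toℕ j ≤_) y≡σi j≤y)
    no-strand-below-i : ∀ b → sv b < sv i → ⊥
    no-strand-below-i b σb<σi
      with cut-crossed-upward (toℕ j) (subst (0 <_) σi≡j (≤-<-trans z≤n σb<σi)) (toℕ<n j)
    ... | b′ , b′<j , j≤σb′
      with sv-injective {b′} {i} (≤-antisym (subst (sv b′ ≤_) y≡σi (clear b′ b′<j))
                                            (subst (_≤ sv b′) (sym σi≡j) j≤σb′))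
    ... | refl = <-asym b′<j (subst (_< toℕ b′) v≡j (<-≤-trans (n<1+n _) v+1≤i))
  Up-pred (along-vertical {st = descending σi<i _ _} {st′ = ascending i<σi _ _} _) _ =
    ⊥-elim (<-asym i<σi σi<i)
  Up-pred (along-horizontal {st = descending σi<i _ _} {st′ = ascending i<σi _ _} _) _ =
    ⊥-elim (<-asym i<σi σi<i)
  Up-pred (along-vertical      {st′ = inj₂ _} _)   ()
  Up-pred (along-horizontal    {st′ = inj₂ _} _)   ()
  Up-pred (vertical→horizontal {st′ = inj₂ _} _ _) ()
  Up-pred (horizontal→vertical {st′ = inj₂ _} _ _) ()

  Down-pred : ∀ {e e′} → SuccView e e′ → Down e′ → Outer e
  Down-pred (along-vertical {i} {st = descending _ _ w+1<i} {st′ = descending _ σi≤w _} ¬crossing) clear =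
    inj₂ λ c i<c → ≤∧≢⇒< (clear c i<c) λ w+1≡σc → ¬crossing
      (i , c , refl , inj₂ (s≤s σi≤w , w+1<i) ,
       sym w+1≡σc , inj₂ (subst (_< toℕ i) w+1≡σc w+1<i , i<c))
  Down-pred (along-horizontal {st = descending _ _ _} {st′ = descending _ _ _} _) clear =
    inj₂ λ b σb<σi → m≤n⇒m≤1+n (clear b σb<σi)
  Down-pred (vertical→horizontal {i} {st = descending _ σi≤v _} {st′ = descending _ _ _} w+1≡i v≡σj) clear
    with sv-injective (≤-antisym (≮⇒≥ λ σi<σj → <⇒≱ (≤-reflexive w+1≡i) (clear i σi<σj))
                                 (subst (sv i ≤_) v≡σj σi≤v))
  ... | refl = inj₂ (subst (ClearRight i) (sym v≡σj) (ClearBelow-corner clear w+1≡i))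
  Down-pred (vertical→horizontal {st = ascending _ i≤u _} {st′ = descending _ σj≤w _} w+1≡i u+1≡σj) _ =
    ⊥-elim (<⇒≱ (≤-reflexive u+1≡σj)
                (≤-trans σj≤w (≤-trans (n≤1+n _) (≤-trans (≤-reflexive w+1≡i) i≤u))))
  Down-pred (horizontal→vertical {st = descending _ _ _} {st′ = descending _ _ _} v≡j y≡σi) clear =
    inj₂ λ b σb<σi → ≮⇒≥ λ v<b →
      <⇒≱ (clear b (subst (_< toℕ b) v≡j v<b)) (s≤s⁻¹ (subst (sv b <_) (sym y≡σi) σb<σi))
  Down-pred (horizontal→vertical {i} {j} {st = ascending _ i≤u u+1≤σi} {st′ = descending _ _ y≤j}
                                 u+1≡j y≡σi) clear =
    inj₁ λ b σi<σb → ⊥-elim (no-strand-above-i b σi<σb)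
    where
    σi≡j : sv i ≡ toℕ j
    σi≡j = ≤-antisym (subst (_≤ toℕ j) y≡σi y≤j) (subst (_≤ sv i) u+1≡j u+1≤σi)
    no-strand-above-i : ∀ b → sv i < sv b → ⊥
    no-strand-above-i b σi<σb
      with cut-crossed-downward (suc (toℕ j)) (s≤s z≤n)
                                (≤-<-trans (subst (_< sv b) σi≡j σi<σb) (toℕ<n (s b)))
    ... | b′ , j<b′ , σb′≤j
      with sv-injective {b′} {i} (≤-antisym (subst (sv b′ ≤_) (sym σi≡j) (s≤s⁻¹ σb′≤j))
                                            (subst (_≤ sv b′) y≡σi (clear b′ j<b′)))
    ... | refl = <-asym j<b′ (subst (toℕ i <_) u+1≡j (s≤s i≤u))
  Down-pred (along-vertical {st = ascending i<σi _ _} {st′ = descending σi<i _ _} _) _ =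
    ⊥-elim (<-asym i<σi σi<i)
  Down-pred (along-horizontal {st = ascending i<σi _ _} {st′ = descending σi<i _ _} _) _ =
    ⊥-elim (<-asym i<σi σi<i)
  Down-pred (along-vertical      {st′ = inj₁ _} _)   ()
  Down-pred (along-horizontal    {st′ = inj₁ _} _)   ()
  Down-pred (vertical→horizontal {st′ = inj₁ _} _ _) ()
  Down-pred (horizontal→vertical {st′ = inj₁ _} _ _) ()

  Outer-succ : ∀ {e e′} → Succ e e′ → Outer e → Outer e′
  Outer-succ e→e′ (inj₁ up)   = Up-succ (succView e→e′) up
  Outer-succ e→e′ (inj₂ down) = [ inj₂ , inj₁ ∘ proj₁ ]′ (Down-succ (succView e→e′) down)

  Outer-pred : ∀ {e e′} → Succ e e′ → Outer e′ → Outer e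
  Outer-pred e→e′ = [ Up-pred (succView e→e′) , Down-pred (succView e→e′) ]′

  Outer-resp-SameCircle : ∀ {e e′} → SameCircle e e′ → Outer e → Outer e′
  Outer-resp-SameCircle ε                 = id
  Outer-resp-SameCircle (fwd e→e′ ◅ rest) = Outer-resp-SameCircle rest ∘ Outer-succ e→e′
  Outer-resp-SameCircle (bwd e′→e ◅ rest) = Outer-resp-SameCircle rest ∘ Outer-pred e′→e

  0<σ0 : 0 < sv fzero
  0<σ0 = n≢0⇒n>0 λ σ0≡0 → no-fixed-point fzero (toℕ-injective σ0≡0)

  S₀ : Edge
  S₀ = edge fzero true 0 1 (ascending 0<σ0 z≤n 0<σ0)

  Outer-S₀ : Outer S₀
  Outer-S₀ = inj₁ λ _ ()

  origin-not-crossing : ¬ IsCrossing (0 , 0)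
  origin-not-crossing (_ , _ , _ , inj₁ (() , _) , _)
  origin-not-crossing (_ , _ , _ , inj₂ (() , _) , _)

  level : Point → ℕ
  level (x , y) = x + y

  level-start<2N : ∀ e → level (start e) < N + N
  level-start<2N (edge i true  _ _ st) = +-mono-< (toℕ<n i) (Step-from<n st)
  level-start<2N (edge i false _ _ st) = +-mono-< (Step-from<n st) (toℕ<n (s i))

  level-Up : ∀ e → Up e → level (end e) ≡ suc (level (start e))
  level-Up (edge i true  u _ (ascending _ _ _)) _ = +-suc (toℕ i) u
  level-Up (edge i false u _ (ascending _ _ _)) _ = refl
  level-Up (edge _ true  _ _ (inj₂ _)) ()
  level-Up (edge _ false _ _ (inj₂ _)) ()

  level-Down : ∀ e → Down e → level (start e) ≡ suc (level (end e))
  level-Down (edge i true  _ v (descending _ _ _)) _ = +-suc (toℕ i) v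
  level-Down (edge i false _ v (descending _ _ _)) _ = refl
  level-Down (edge _ true  _ _ (inj₁ _)) ()
  level-Down (edge _ false _ _ (inj₁ _)) ()

  Down-connected : ∀ k e → Down e → level (start e) ≤ k → SameCircle e S₀
  Down-connected k e down bound with successor e
  ... | e′ , e→e′ with Down-succ (succView e→e′) down
  ... | inj₂ (_ , at-origin) =
    fwd (at-origin , ⊥-elim ∘ origin-not-crossing ∘ subst IsCrossing at-origin) ◅ ε
  ... | inj₁ down′ with k | subst (_≤ k) (level-Down e down) bound
  ... | suc k′ | s≤s bound′ =
    fwd e→e′ ◅ Down-connected k′ e′ down′ (subst (λ p → level p ≤ k′) (proj₁ e→e′) bound′)

  -- k bounds the number of ascending steps still possible, as every start point has level < N + N.
  Up-connected : ∀ k e → Up e → N + N ≤ level (start e) + k → SameCircle e S₀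
  Up-connected zero e up bound =
    ⊥-elim (<⇒≱ (level-start<2N e) (subst (N + N ≤_) (+-identityʳ _) bound))
  Up-connected (suc k) e up bound with successor e
  ... | e′ , e→e′ with Up-succ (succView e→e′) up
  ... | inj₂ down′ = fwd e→e′ ◅ Down-connected _ e′ down′ ≤-refl
  ... | inj₁ up′   =
    fwd e→e′ ◅ Up-connected k e′ up′
                 (subst (λ t → N + N ≤ t + k) level-e′ (subst (N + N ≤_) (+-suc _ k) bound))
    where
    level-e′ : suc (level (start e)) ≡ level (start e′)
    level-e′ = trans (sym (level-Up e up)) (cong level (proj₁ e→e′))

  Outer⇒SameCircle-S₀ : ∀ {e} → Outer e → SameCircle e S₀
  Outer⇒SameCircle-S₀ {e} (inj₁ up)   = Up-connected (N + N) e up (m≤n+m (N + N) _)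
  Outer⇒SameCircle-S₀ {e} (inj₂ down) = Down-connected _ e down ≤-refl

  SameCircle-S₀⇒Outer : ∀ {e} → SameCircle e S₀ → Outer e
  SameCircle-S₀⇒Outer e∼S₀ = Outer-resp-SameCircle (SameCircle-sym e∼S₀) Outer-S₀

  AscendsAcross DescendsAcross : ℕ → Fin N → Set
  AscendsAcross y b = toℕ b ≤ y × y < sv b
  DescendsAcross y b = sv b ≤ y × y < toℕ b

  inside-vertical : ∀ i y → AscendsAcross y i ⊎ DescendsAcross y i → (DescendsAcross y i → ¬ ClearRight i y) →
                    Parity (λ c → toℕ i < c × VerticalOn S₀ y c) (upTo N) true
  inside-vertical i y across ¬outer with cut-crossed-downward (suc y) (s≤s z≤n) y+1<N
    where
    y+1<N : suc y < N
    y+1<N = [ (λ (_ , y<σi) → ≤-<-trans y<σi (toℕ<n (s i))) ,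
              (λ (_ , y<i)  → ≤-<-trans y<i (toℕ<n i)) ]′ across
  ... | b , y<b , σb≤y
    with max-satisfying (λ c → (sv c ≤? y) ×-dec (y <? toℕ c)) toℕ {b} (s≤s⁻¹ σb≤y , y<b)
  ... | cR , (σcR≤y , y<cR) , rightmost =
    Parity-applyUpTo-unique id (toℕ cR) (toℕ<n cR)
      (i<cR , gR , refl , refl , m≥n⇒m⊓n≡n (n≤1+n y) , Outer⇒SameCircle-S₀ (inj₂ clearR)) unique
    where
    clearR : ClearRight cR y
    clearR c cR<c = ≰⇒> λ σc≤y → <⇒≱ cR<c (rightmost c (σc≤y , <-trans y<cR cR<c))
    gR : Edge
    gR = edge cR true (suc y) y (descending (≤-<-trans σcR≤y y<cR) σcR≤y y<cR)
    i<cR : toℕ i < toℕ cR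
    i<cR = [ (λ (i≤y , _) → ≤-<-trans i≤y y<cR) ,
             (λ falls → ≤∧≢⇒< (rightmost i falls) λ i≡cR →
               ¬outer falls (subst (λ c → ClearRight c y) (sym (toℕ-injective i≡cR)) clearR)) ]′ across
    ascending-right-of-i : ∀ {j u} → toℕ i < toℕ j → toℕ j ≤ u → ClearLeft j u → u ≡ y → ⊥
    ascending-right-of-i i<j j≤u clearL refl =
      [ (λ (_ , y<σi) → <⇒≱ y<σi (clearL i i<j)) ,
        (λ (_ , y<i)  → <⇒≱ (<-≤-trans y<i (<⇒≤ i<j)) j≤u) ]′ across
    descending-is-rightmost : ∀ {j} → DescendsAcross y j → ClearRight j y → toℕ j ≡ toℕ cR
    descending-is-rightmost {j} falls clearRj =
      ≤-antisym (rightmost j falls) (≮⇒≥ λ j<cR → <⇒≱ (clearRj cR j<cR) σcR≤y)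
    unique : ∀ c → toℕ i < c × VerticalOn S₀ y c → c ≡ toℕ cR
    unique c (i<c , edge j true u′ v′ st′ , refl , j≡c , row , g∼S₀)
      with st′ | SameCircle-S₀⇒Outer g∼S₀
    ... | inj₁ _ | inj₂ ()
    ... | inj₂ _ | inj₁ ()
    ... | ascending _ j≤u′ _ | inj₁ clearL =
      ⊥-elim (ascending-right-of-i (subst (toℕ i <_) (sym j≡c) i<c) j≤u′ clearL
                                (trans (sym (m≤n⇒m⊓n≡m (n≤1+n u′))) row))
    ... | descending _ σj≤v′ v′<j | inj₂ clearRj with trans (sym (m≥n⇒m⊓n≡n (n≤1+n v′))) row
    ...   | refl = trans (sym j≡c) (descending-is-rightmost (σj≤v′ , v′<j) clearRj)

  inside-horizontal : ∀ i x → AscendsAcross x i ⊎ DescendsAcross x i → (AscendsAcross x i → ¬ ClearAbove i x) →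
                      Parity (λ r → sv i < r × HorizontalOn S₀ x r) (upTo N) true
  inside-horizontal i x across ¬outer with cut-crossed-upward (suc x) (s≤s z≤n) x+1<N
    where
    x+1<N : suc x < N
    x+1<N = [ (λ (_ , x<σi) → ≤-<-trans x<σi (toℕ<n (s i))) ,
              (λ (_ , x<i)  → ≤-<-trans x<i (toℕ<n i)) ]′ across
  ... | b , b≤x , x<σb
    with max-satisfying (λ c → (toℕ c ≤? x) ×-dec (x <? sv c)) sv {b} (s≤s⁻¹ b≤x , x<σb)
  ... | bT , (bT≤x , x<σbT) , topmost =
    Parity-applyUpTo-unique id (sv bT) (toℕ<n (s bT))
      (σi<σbT , gT , refl , refl , m≤n⇒m⊓n≡m (n≤1+n x) , Outer⇒SameCircle-S₀ (inj₁ clearT)) unique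
    where
    clearT : ClearAbove bT x
    clearT b σbT<σb = ≰⇒> λ b≤x → <⇒≱ σbT<σb (topmost b (b≤x , <-trans x<σbT σbT<σb))
    gT : Edge
    gT = edge bT false x (suc x) (ascending (≤-<-trans bT≤x x<σbT) bT≤x x<σbT)
    σi<σbT : sv i < sv bT
    σi<σbT = [ (λ rises → ≤∧≢⇒< (topmost i rises) λ σi≡σbT →
                            ¬outer rises (subst (λ c → ClearAbove c x) (sym (sv-injective σi≡σbT)) clearT)) ,
               (λ (σi≤x , _) → ≤-<-trans σi≤x x<σbT) ]′ across
    descending-above-i : ∀ {j v} → sv i < sv j → sv j ≤ v → ClearBelow j v → v ≡ x → ⊥
    descending-above-i σi<σj σj≤v clearB refl =
      [ (λ (_ , x<σi) → <⇒≱ (<-trans x<σi σi<σj) σj≤v) ,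
        (λ (_ , x<i)  → <⇒≱ x<i (clearB i σi<σj)) ]′ across
    ascending-is-topmost : ∀ {j} → AscendsAcross x j → ClearAbove j x → sv j ≡ sv bT
    ascending-is-topmost {j} rises clearAj =
      ≤-antisym (topmost j rises) (≮⇒≥ λ σj<σbT → <⇒≱ (clearAj bT σj<σbT) bT≤x)
    unique : ∀ r → sv i < r × HorizontalOn S₀ x r → r ≡ sv bT
    unique r (σi<r , edge j false u′ v′ st′ , refl , σj≡r , row , g∼S₀)
      with st′ | SameCircle-S₀⇒Outer g∼S₀
    ... | inj₁ _ | inj₂ ()
    ... | inj₂ _ | inj₁ ()
    ... | descending _ σj≤v′ _ | inj₂ clearB =
      ⊥-elim (descending-above-i (subst (sv i <_) (sym σj≡r) σi<r) σj≤v′ clearB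
                              (trans (sym (m≥n⇒m⊓n≡n (n≤1+n v′))) row))
    ... | ascending _ j≤u′ u′<σj | inj₁ clearAj with trans (sym (m≤n⇒m⊓n≡m (n≤1+n u′))) row
    ...   | refl = trans (sym σj≡r) (ascending-is-topmost (j≤u′ , u′<σj) clearAj)

  inside : ∀ f → ¬ SameCircle f S₀ → InsideAt S₀ f
  inside (edge i true u _ (ascending _ i≤u u<σi)) _ rewrite m≤n⇒m⊓n≡m (n≤1+n u) =
    inside-vertical i u (inj₁ (i≤u , u<σi)) (λ (σi≤u , _) _ → <⇒≱ u<σi σi≤u)
  inside (edge i true _ v (descending _ σi≤v v<i)) f≁S₀ rewrite m≥n⇒m⊓n≡n (n≤1+n v) =
    inside-vertical i v (inj₂ (σi≤v , v<i)) λ _ clearR → f≁S₀ (Outer⇒SameCircle-S₀ (inj₂ clearR))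
  inside (edge i false u _ (ascending _ i≤u u<σi)) f≁S₀ rewrite m≤n⇒m⊓n≡m (n≤1+n u) =
    inside-horizontal i u (inj₁ (i≤u , u<σi)) λ _ clearA → f≁S₀ (Outer⇒SameCircle-S₀ (inj₁ clearA))
  inside (edge i false _ v (descending _ σi≤v v<i)) _ rewrite m≥n⇒m⊓n≡n (n≤1+n v) =
    inside-horizontal i v (inj₂ (σi≤v , v<i)) (λ (i≤v , _) _ → <⇒≱ v<i i≤v)

  below-S₀ : ∀ T → ¬ SameCircle T S₀ → T ≺ S₀
  below-S₀ T T≁S₀ = T≁S₀ , λ f f∼T → inside f λ f∼S₀ →
    T≁S₀ (SameCircle-trans (SameCircle-sym f∼T) f∼S₀)

  bottom-vertical-Outer : ∀ {j u v} (st : Step (toℕ j) (sv j) u v) → 0 < toℕ j → u ⊓ v ≡ 0 →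
                          Outer (edge j true u v st)
  bottom-vertical-Outer (ascending _ j≤u _) 0<j row =
    ⊥-elim (<⇒≱ 0<j (≤-trans j≤u (≤-reflexive (trans (sym (m≤n⇒m⊓n≡m (n≤1+n _))) row))))
  bottom-vertical-Outer (descending _ σj≤v _) _ row with trans (sym (m≥n⇒m⊓n≡n (n≤1+n _))) row
  ... | refl = inj₂ λ c j<c → n≢0⇒n>0 λ σc≡0 →
    <-irrefl (cong toℕ (sv-injective (trans (n≤0⇒n≡0 σj≤v) (sym σc≡0)))) j<c

  S₀-maximal : Maximal S₀
  S₀-maximal T (S₀≁T , S₀-inside) with Parity-false no-edge-of-T-on-ray (S₀-inside S₀ ε)
    where
    no-edge-of-T-on-ray : ∀ c → ¬ (0 < c × VerticalOn T 0 c)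
    no-edge-of-T-on-ray _ (0<c , edge _ true _ _ st , refl , refl , row , g∼T) =
      S₀≁T (SameCircle-trans (SameCircle-sym (Outer⇒SameCircle-S₀ (bottom-vertical-Outer st 0<c row))) g∼T)
  ... | ()

  maximal⇒SameCircle-S₀ : ∀ T → Maximal T → SameCircle T S₀
  maximal⇒SameCircle-S₀ T T-maximal with Outer? T
  ... | yes outer = Outer⇒SameCircle-S₀ outer
  ... | no ¬outer = ⊥-elim (T-maximal S₀ (below-S₀ T (¬outer ∘ SameCircle-S₀⇒Outer)))

mainTheorem17 : ∀ {n : ℕ} (σ : Permutation′ n) → 2 ≤ n → CycleDiagram.IsNCycle σ →
    ∃[ S ] (CycleDiagram.Maximal σ S ×
            (∀ T → CycleDiagram.Maximal σ T → CycleDiagram.SameCircle σ T S) ×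
            (∀ T → ¬ CycleDiagram.SameCircle σ T S → CycleDiagram._≺_ σ T S))
mainTheorem17 {suc (suc m)} σ (s≤s (s≤s z≤n)) cycle =
  S₀ , S₀-maximal , maximal⇒SameCircle-S₀ , below-S₀
  where open OuterCircle m σ cycle
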